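{- Let $n$ and $k$ be positive integers, and let $m=nt+r$ with $t,r$ nonnegative integers. Then $$P'(\underbrace{k,\ldots,k}_{m})\equiv P'(\underbrace{k,\ldots,k}_{r})\,\bigl(P'(\underbrace{k,\ldots,k}_{n})\bigr)^t\pmod{n}.$$
   Context: $P'(s_1,\dots,s_r)$ is the number of anagrams without fixed letters of the word $1^{s_1}2^{s_2}\cdots r^{s_r}$, i.e. the number of words $a_{1,1}\ldots a_{1,s_1}\ldots a_{r,1}\ldots a_{r,s_r}$ that are rearrangements of $1^{s_1}\cdots r^{s_r}$ with $a_{i,j}\neq i$ for all $i,j$. With zero arguments (empty word), $P'$ equals $1$. -}

module Defs where

open import Data.Nat using (ℕ; zero; suc; _+_)
open import Data.Fin using (Fin; zero; suc)
open import Data.Fin.Properties using () renaming (_≟_ to _≟ᶠ_)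
open import Data.Vec using (Vec; []; _∷_; replicate; lookup; allFin; toList)
open import Data.List as L using (List; []; _∷_; _++_; concatMap; filter; length)
open import Data.Product using (_×_)
open import Relation.Nullary using (Dec; ¬_; yes; no)
open import Relation.Nullary.Decidable using (_×-dec_; ¬?)
open import Data.List.Relation.Unary.All using (All)
import Data.List.Relation.Unary.All as All
import Data.Nat.Properties as ℕP
open import Relation.Binary.PropositionalEquality using (_≡_)

baseWord : ∀ {r} → Vec ℕ r → List (Fin r)
baseWord {r} s = concatMap (λ i → L.replicate (lookup s i) i) (toList (allFin r))

allWords : (r N : ℕ) → List (List (Fin r))
allWords r zero    = [] ∷ []
allWords r (suc N) = concatMap (λ a → L.map (a ∷_) (allWords r N)) (toList (allFin r))

occ : ∀ {r} → Fin r → List (Fin r) → ℕ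
occ a w = length (filter (a ≟ᶠ_) w)

IsRearrangement : ∀ {r} → List (Fin r) → List (Fin r) → Set
IsRearrangement {r} w u = All (λ a → occ a w ≡ occ a u) (toList (allFin r))

data NoFixed {r} : List (Fin r) → List (Fin r) → Set where
  []  : NoFixed [] []
  _∷_ : ∀ {a b w u} → ¬ a ≡ b → NoFixed w u → NoFixed (a ∷ w) (b ∷ u)

noFixed? : ∀ {r} (w u : List (Fin r)) → Dec (NoFixed w u)
noFixed? [] [] = yes []
noFixed? [] (_ ∷ _) = no λ ()
noFixed? (_ ∷ _) [] = no λ ()
noFixed? (a ∷ w) (b ∷ u) with a ≟ᶠ b | noFixed? w u
... | yes e | _ = no λ { (ne ∷ _) → ne e }
... | no ne | yes p = yes (ne ∷ p)
... | no _ | no ¬p = no λ { (_ ∷ p) → ¬p p }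

isRearrangement? : ∀ {r} (w u : List (Fin r)) → Dec (IsRearrangement w u)
isRearrangement? {r} w u = All.all? (λ a → occ a w ℕP.≟ occ a u) (toList (allFin r))

P′ : ∀ {r} → Vec ℕ r → ℕ
P′ {r} s = length (filter (λ w → isRearrangement? w u ×-dec noFixed? w u)
                          (allWords r (length u)))
  where u = baseWord s

module Submission where

open import Defs
open import Data.Nat using (ℕ; zero; suc; _+_; _*_; _∸_; _^_; _%_; _!; _≤_; _<_; s≤s; pred; NonZero)
open import Data.Vec using (replicate; lookup; tabulate; allFin; toList)
open import Relation.Binary.PropositionalEquality

import Data.Nat.Properties as ℕP
import Data.Nat.DivMod as ℕD
open import Data.Nat.Divisibility using () renaming (_∣_ to _ℕ∣_)
open import Data.Nat.Induction using (<-rec)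
open import Data.Nat.Tactic.RingSolver using () renaming (solve-∀ to ℕ-solve)
open import Data.Integer as ℤ using (ℤ; +_; -1ℤ)
  renaming (_+_ to _+ℤ_; _*_ to _*ℤ_; -_ to -ℤ_; _-_ to _-ℤ_; _^_ to _^ℤ_)
import Data.Integer.Properties as ℤP
open import Data.Integer.Divisibility.Signed using (_∣_; divides; ∣m∣n⇒∣m+n; ∣n⇒∣m*n; ∣m⇒∣-m; ∣⇒∣ᵤ)
open import Data.Integer.Tactic.RingSolver using (solve-∀)
open import Data.Fin using (Fin; zero; suc; toℕ; inject₁; fromℕ; punchIn)
import Data.Fin.Properties as FinP
open import Data.Fin.Properties using (punchInᵢ≢i) renaming (_≟_ to _≟ᶠ_)
import Data.Vec.Properties as VecP
import Data.Vec.Relation.Unary.All.Properties as VecAll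
open import Data.Vec.Functional using (Vector; head; tail; init; last; updateAt; removeAt)
open import Data.Vec.Functional.Properties using (updateAt-updates; updateAt-minimal)
open import Data.List as List using (List; []; _∷_; _++_; length; filter; concatMap; map)
import Data.List.Properties as LP
open import Data.List.Relation.Unary.All using (All; universal)
import Data.List.Relation.Unary.All as All
open import Data.Product using (_,_)
open import Data.Sum using (inj₁; inj₂)
open import Data.Bool using (true; false)
open import Function using (_∘_)
open import Relation.Nullary using (Dec; yes; no; ¬_; does)
open import Relation.Nullary.Decidable using (_×-dec_)
open import Relation.Unary using (Decidable)
open import Relation.Binary.Bundles using (Setoid)
import Relation.Binary.Reasoning.Setoid as SetoidReasoning
open import Algebra.Properties.Semiring.Sum ℤP.+-*-semiring
import Algebra.Properties.Semiring.Sum as SemiringSum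
module ℕΣ = SemiringSum ℕP.+-*-semiring

-- Consider polynomials in the divided powers x⁽ᶜ⁾ = xᶜ/c! with
-- integer coefficients, and the functional φ(x⁽ᶜ⁾) = 1.  Inclusion–exclusion
-- gives P′(s₁,…,s_r) = φ(Π_i f_{s_i,s_i}), where f_{t,q} =
-- Σ_j (−1)ʲ C(t,j) x⁽q−j⁾; hence P′(kᵐ) = φ(pᵐ) for p = f_{k,k}.  Since
-- φ(H) = H(0) + φ(H′) and (pⁿG)′ = pⁿG′ + n·p′pⁿ⁻¹G, induction on the degree
-- of G gives φ(pⁿG) ≡ p(0)ⁿ φ(G) (mod n).  Taking G = pᵐ yields
-- P′(kⁿ⁺ᵐ) ≡ p(0)ⁿ P′(kᵐ), in particular P′(kⁿ) ≡ p(0)ⁿ, and iterating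
-- gives the corollary.
--
-- Polynomials are represented through their moment sequences
-- c ↦ φ(x⁽ᶜ⁾ G), on which multiplication by a polynomial is an explicit
-- finite sum (_⊛_).

infix 4 _≡_[mod_]
record _≡_[mod_] (a b : ℤ) (n : ℕ) : Set where
  constructor mod-by
  field divides-difference : + n ∣ a -ℤ b
open _≡_[mod_]

module _ {n : ℕ} where

  private
    by : ∀ {a b e} → a -ℤ b ≡ e → + n ∣ e → a ≡ b [mod n ]
    by eq n∣e = mod-by (subst (+ n ∣_) (sym eq) n∣e)

  ≡⇒≡mod : ∀ {a b} → a ≡ b → a ≡ b [mod n ]
  ≡⇒≡mod {a} refl = by (ℤP.+-inverseʳ a) (divides (+ 0) refl)

  mod-sym : ∀ {a b} → a ≡ b [mod n ] → b ≡ a [mod n ]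
  mod-sym {a} {b} a≡b = by (flip b a) (∣m⇒∣-m (divides-difference a≡b))
    where flip : ∀ b a → b -ℤ a ≡ -ℤ (a -ℤ b)
          flip = solve-∀

  mod-trans : ∀ {a b c} → a ≡ b [mod n ] → b ≡ c [mod n ] → a ≡ c [mod n ]
  mod-trans {a} {b} {c} a≡b b≡c = by (split a b c) (∣m∣n⇒∣m+n (divides-difference a≡b) (divides-difference b≡c))
    where split : ∀ a b c → a -ℤ c ≡ (a -ℤ b) +ℤ (b -ℤ c)
          split = solve-∀

  mod-+ : ∀ {a b c d} → a ≡ b [mod n ] → c ≡ d [mod n ] → a +ℤ c ≡ b +ℤ d [mod n ]
  mod-+ {a} {b} {c} {d} a≡b c≡d = by (regroup a b c d) (∣m∣n⇒∣m+n (divides-difference a≡b) (divides-difference c≡d))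
    where regroup : ∀ a b c d → (a +ℤ c) -ℤ (b +ℤ d) ≡ (a -ℤ b) +ℤ (c -ℤ d)
          regroup = solve-∀

  mod-*ˡ : ∀ x {a b} → a ≡ b [mod n ] → x *ℤ a ≡ x *ℤ b [mod n ]
  mod-*ˡ x {a} {b} a≡b = by (factor-out x a b) (∣n⇒∣m*n x (divides-difference a≡b))
    where factor-out : ∀ x a b → x *ℤ a -ℤ x *ℤ b ≡ x *ℤ (a -ℤ b)
          factor-out = solve-∀

  mod-*ʳ : ∀ x {a b} → a ≡ b [mod n ] → a *ℤ x ≡ b *ℤ x [mod n ]
  mod-*ʳ x {a} {b} a≡b = by (factor-out x a b) (∣n⇒∣m*n x (divides-difference a≡b))
    where factor-out : ∀ x a b → a *ℤ x -ℤ b *ℤ x ≡ x *ℤ (a -ℤ b)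
          factor-out = solve-∀

  mod-^ : ∀ t {a b} → a ≡ b [mod n ] → a ^ℤ t ≡ b ^ℤ t [mod n ]
  mod-^ zero    a≡b = ≡⇒≡mod refl
  mod-^ (suc t) {a} {b} a≡b = mod-trans (mod-*ʳ (a ^ℤ t) a≡b) (mod-*ˡ b (mod-^ t a≡b))

  mod-+-multiple : ∀ a x → a +ℤ + n *ℤ x ≡ a [mod n ]
  mod-+-multiple a x = by (cancel a (+ n) x) (divides x refl)
    where cancel : ∀ a n x → a +ℤ n *ℤ x -ℤ a ≡ x *ℤ n
          cancel = solve-∀

  modSetoid : Setoid _ _
  modSetoid = record
    { Carrier       = ℤ
    ; _≈_           = _≡_[mod n ]
    ; isEquivalence = record { refl = ≡⇒≡mod refl ; sym = mod-sym ; trans = mod-trans }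
    }

%-of-larger : ∀ {a b} n .{{_ : NonZero n}} → b ≤ a → + a ≡ + b [mod n ] → b % n ≡ a % n
%-of-larger {a} {b} n b≤a (mod-by n∣a-b) = begin
  b % n               ≡⟨ ℕD.%-remove-+ʳ b n∣a∸b ⟨
  (b + (a ∸ b)) % n   ≡⟨ cong (_% n) (ℕP.m+[n∸m]≡n b≤a) ⟩
  a % n               ∎
  where
  open ≡-Reasoning
  n∣a∸b : n ℕ∣ a ∸ b
  n∣a∸b = subst (n ℕ∣_) (cong ℤ.∣_∣ (trans (ℤP.m-n≡m⊖n a b) (ℤP.⊖-≥ b≤a))) (∣⇒∣ᵤ n∣a-b)

mod⇒% : ∀ {a b} n .{{_ : NonZero n}} → + a ≡ + b [mod n ] → a % n ≡ b % n
mod⇒% {a} {b} n a≡b with ℕP.≤-total b a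
... | inj₁ b≤a = sym (%-of-larger n b≤a a≡b)
... | inj₂ a≤b = %-of-larger n a≤b (mod-sym a≡b)

mod-∑ : ∀ {n r} {f g : Vector ℤ r} → (∀ i → f i ≡ g i [mod n ]) → sum f ≡ sum g [mod n ]
mod-∑ {r = zero}  f≡g = ≡⇒≡mod refl
mod-∑ {r = suc r} f≡g = mod-+ (f≡g zero) (mod-∑ (λ i → f≡g (suc i)))

∑-neg : ∀ {d} (g : Vector ℤ d) → ∑[ u < d ] (-ℤ g u) ≡ -ℤ (∑[ u < d ] g u)
∑-neg {zero}  g = refl
∑-neg {suc d} g = trans (cong (-ℤ g zero +ℤ_) (∑-neg (tail g))) (sym (ℤP.neg-distrib-+ (g zero) _))

pos-sum : ∀ {r} (f : Vector ℕ r) → + ℕΣ.sum f ≡ ∑[ i < r ] (+ f i)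
pos-sum {zero}  f = refl
pos-sum {suc r} f = trans (ℤP.pos-+ (f zero) _) (cong (+ f zero +ℤ_) (pos-sum (f ∘ suc)))

sum-updateAt : ∀ {r} (Q : Vector ℕ (suc r)) b f → ℕΣ.sum (updateAt Q b f) ≡ f (Q b) + ℕΣ.sum (removeAt Q b)
sum-updateAt Q b f = trans (ℕΣ.sum-remove {i = b} (updateAt Q b f))
  (cong₂ _+_ (updateAt-updates b Q) (ℕΣ.sum-cong-≗ λ i → updateAt-minimal (punchIn b i) b Q (punchInᵢ≢i b i)))

sum-lower : ∀ {r} (Q : Vector ℕ r) b {q} → Q b ≡ suc q → suc (ℕΣ.sum (updateAt Q b pred)) ≡ ℕΣ.sum Q
sum-lower {suc r} Q b {q} Qb≡1+q = begin
  suc (ℕΣ.sum (updateAt Q b pred))          ≡⟨ cong suc (sum-updateAt Q b pred) ⟩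
  suc (pred (Q b) + ℕΣ.sum (removeAt Q b))  ≡⟨ cong (λ x → suc (pred x) + ℕΣ.sum (removeAt Q b)) Qb≡1+q ⟩
  suc q + ℕΣ.sum (removeAt Q b)             ≡⟨ cong (_+ ℕΣ.sum (removeAt Q b)) Qb≡1+q ⟨
  Q b + ℕΣ.sum (removeAt Q b)               ≡⟨ ℕΣ.sum-remove {i = b} Q ⟨
  ℕΣ.sum Q                                  ∎
  where open ≡-Reasoning

sum-zero : ∀ {r} (Q : Vector ℕ r) → ℕΣ.sum Q ≡ 0 → ∀ a → Q a ≡ 0
sum-zero {suc r} Q ΣQ≡0 a = ℕP.m+n≡0⇒m≡0 (Q a) (trans (sym (ℕΣ.sum-remove {i = a} Q)) ΣQ≡0)

binom : ℕ → ℕ → ℕ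
binom t       zero    = 1
binom zero    (suc j) = 0
binom (suc t) (suc j) = binom t j + binom t (suc j)

binom-above : ∀ {t j} → t < j → binom t j ≡ 0
binom-above {zero}  {suc j} _         = refl
binom-above {suc t} {suc j} (s≤s t<j) = cong₂ _+_ (binom-above t<j) (binom-above (ℕP.m≤n⇒m≤1+n t<j))

-- In divided powers x⁽ᵃ⁾ = xᵃ/a! it is
-- the structure constant  x⁽ᵃ⁾ · x⁽ᵇ⁾ = shuffles a b · x⁽ᵃ⁺ᵇ⁾.
shuffles : ℕ → ℕ → ℕ
shuffles a       zero    = 1
shuffles zero    (suc b) = 1
shuffles (suc a) (suc b) = shuffles a (suc b) + shuffles (suc a) b

shuffles-zeroˡ : ∀ b → shuffles 0 b ≡ 1
shuffles-zeroˡ zero    = refl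
shuffles-zeroˡ (suc b) = refl

shuffles-factorial : ∀ a b → shuffles a b * (a ! * b !) ≡ (a + b) !
shuffles-factorial a zero = trans (ℕP.*-identityˡ _) (trans (ℕP.*-identityʳ (a !)) (cong _! (sym (ℕP.+-identityʳ a))))
shuffles-factorial zero (suc b) = trans (ℕP.*-identityˡ _) (ℕP.*-identityˡ _)
shuffles-factorial (suc a) (suc b) = begin
  (shuffles a (suc b) + shuffles (suc a) b) * (suc a ! * suc b !)
    ≡⟨ split (shuffles a (suc b)) (shuffles (suc a) b) a b (a !) (b !) ⟩
  suc a * (shuffles a (suc b) * (a ! * suc b !)) + suc b * (shuffles (suc a) b * (suc a ! * b !))
    ≡⟨ cong₂ (λ x y → suc a * x + suc b * y) (shuffles-factorial a (suc b)) (shuffles-factorial (suc a) b) ⟩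
  suc a * (a + suc b) ! + suc b * (suc a + b) !
    ≡⟨ cong (λ m → suc a * m ! + suc b * (suc a + b) !) (ℕP.+-suc a b) ⟩
  suc a * suc (a + b) ! + suc b * suc (a + b) !
    ≡⟨ collect a b (suc (a + b) !) ⟩
  suc (suc (a + b)) * suc (a + b) !
    ≡⟨ cong (λ m → suc m !) (ℕP.+-suc a b) ⟨
  (suc a + suc b) !
    ∎
  where
  open ≡-Reasoning
  split : ∀ x y a b fa fb → (x + y) * ((suc a * fa) * (suc b * fb))
                          ≡ suc a * (x * (fa * (suc b * fb))) + suc b * (y * ((suc a * fa) * fb))
  split = ℕ-solve
  collect : ∀ a b N → suc a * N + suc b * N ≡ suc (suc (a + b)) * N
  collect = ℕ-solve

-- Both sides count the ways to interleave three words of lengths c, u, v: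
-- shuffles c u · shuffles (c+u) v = (c+u+v)! / (c! u! v!).
shuffles-swap : ∀ c u v → shuffles c u * shuffles (c + u) v ≡ shuffles c v * shuffles (c + v) u
shuffles-swap c u v = ℕP.*-cancelʳ-≡ _ _ (c ! * (u ! * v !)) {{nonZero}} (begin
  shuffles c u * shuffles (c + u) v * (c ! * (u ! * v !))   ≡⟨ trinomial c u v ⟩
  (c + u + v) !                                              ≡⟨ cong _! (exchange c u v) ⟩
  (c + v + u) !                                              ≡⟨ trinomial c v u ⟨
  shuffles c v * shuffles (c + v) u * (c ! * (v ! * u !))   ≡⟨ cong (λ m → shuffles c v * shuffles (c + v) u * (c ! * m)) (ℕP.*-comm (v !) (u !)) ⟩
  shuffles c v * shuffles (c + v) u * (c ! * (u ! * v !))   ∎)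
  where
  open ≡-Reasoning
  nonZero : NonZero (c ! * (u ! * v !))
  nonZero = ℕP.m*n≢0 (c !) (u ! * v !) {{ℕP._!≢0 c}} {{ℕP._!*_!≢0 u v}}
  exchange : ∀ c u v → c + u + v ≡ c + v + u
  exchange = ℕ-solve
  regroup : ∀ x y fc fu fv → x * y * (fc * (fu * fv)) ≡ y * ((x * (fc * fu)) * fv)
  regroup = ℕ-solve
  trinomial : ∀ c u v → shuffles c u * shuffles (c + u) v * (c ! * (u ! * v !)) ≡ (c + u + v) !
  trinomial c u v = begin
    shuffles c u * shuffles (c + u) v * (c ! * (u ! * v !))   ≡⟨ regroup (shuffles c u) _ (c !) (u !) (v !) ⟩
    shuffles (c + u) v * (shuffles c u * (c ! * u !) * v !)   ≡⟨ cong (λ m → shuffles (c + u) v * (m * v !)) (shuffles-factorial c u) ⟩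
    shuffles (c + u) v * ((c + u) ! * v !)                    ≡⟨ shuffles-factorial (c + u) v ⟩
    (c + u + v) !                                              ∎

-- For a polynomial G in the divided powers
-- x⁽ᶜ⁾ = xᶜ/c!, write φ(Σ g_c x⁽ᶜ⁾) = Σ g_c (i.e. φ(xᶜ) = c!); the moment
-- sequence of G is c ↦ φ(x⁽ᶜ⁾ · G).  Every function below on sequences
-- is the shadow of an operation on G.
Seq : Set
Seq = ℕ → ℤ

-- Multiplication of G by p = Σ_{u<d} a_u x⁽ᵘ⁾, seen on moment sequences.
-- The u-th summand is  a_u · shuffles c u · F (c + u).
infixr 6 _⊛_
summand : ∀ {d} → Vector ℤ d → Seq → ℕ → Vector ℤ d
summand a F c u = a u *ℤ (+ shuffles c (toℕ u) *ℤ F (c + toℕ u))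

_⊛_ : ∀ {d} → Vector ℤ d → Seq → Seq
(a ⊛ F) c = sum (summand a F c)

⊛-cong : ∀ {d} (a : Vector ℤ d) {F G : Seq} → F ≗ G → a ⊛ F ≗ a ⊛ G
⊛-cong a F≗G c = sum-cong-≗ λ u → cong (λ x → a u *ℤ (+ shuffles c (toℕ u) *ℤ x)) (F≗G _)

⊛-coeff-cong : ∀ {d} {a b : Vector ℤ d} → a ≗ b → ∀ F → a ⊛ F ≗ b ⊛ F
⊛-coeff-cong a≗b F c = sum-cong-≗ λ u → cong (_*ℤ _) (a≗b u)

⊛-+ : ∀ {d} (a : Vector ℤ d) F G → a ⊛ (λ e → F e +ℤ G e) ≗ λ c → (a ⊛ F) c +ℤ (a ⊛ G) c
⊛-+ a F G c = trans (sum-cong-≗ λ u → distrib (a u) (+ shuffles c (toℕ u)) (F (c + toℕ u)) (G (c + toℕ u)))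
                    (∑-distrib-+ (summand a F c) (summand a G c))
  where distrib : ∀ x s y z → x *ℤ (s *ℤ (y +ℤ z)) ≡ x *ℤ (s *ℤ y) +ℤ x *ℤ (s *ℤ z)
        distrib = solve-∀

⊛-scale : ∀ {d} (a : Vector ℤ d) x F → a ⊛ (λ e → x *ℤ F e) ≗ λ c → x *ℤ (a ⊛ F) c
⊛-scale a x F c = trans (sum-cong-≗ λ u → pull (a u) (+ shuffles c (toℕ u)) x (F (c + toℕ u)))
                        (sym (*-distribˡ-sum x (summand a F c)))
  where pull : ∀ y s x f → y *ℤ (s *ℤ (x *ℤ f)) ≡ x *ℤ (y *ℤ (s *ℤ f))
        pull = solve-∀

⊛-neg : ∀ {d} (a : Vector ℤ d) F → a ⊛ (λ e → -ℤ F e) ≗ λ c → -ℤ (a ⊛ F) c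
⊛-neg a F c = trans (sum-cong-≗ λ u → pull (a u) (+ shuffles c (toℕ u)) (F (c + toℕ u))) (∑-neg (summand a F c))
  where pull : ∀ y s f → y *ℤ (s *ℤ (-ℤ f)) ≡ -ℤ (y *ℤ (s *ℤ f))
        pull = solve-∀

⊛-- : ∀ {d} (a : Vector ℤ d) F G → a ⊛ (λ e → F e -ℤ G e) ≗ λ c → (a ⊛ F) c -ℤ (a ⊛ G) c
⊛-- a F G c = trans (⊛-+ a F (λ e → -ℤ G e) c) (cong ((a ⊛ F) c +ℤ_) (⊛-neg a G c))

⊛-∑ : ∀ {d r} (a : Vector ℤ d) (G : Fin r → Seq) →
      a ⊛ (λ e → ∑[ i < r ] G i e) ≗ λ c → ∑[ i < r ] (a ⊛ G i) c
⊛-∑ {r = r} a G c = trans (sum-cong-≗ λ u → distribute u) (∑-comm λ u i → summand a (G i) c u)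
  where
  distribute : ∀ u → summand a (λ e → ∑[ i < r ] G i e) c u ≡ ∑[ i < r ] summand a (G i) c u
  distribute u = trans (cong (a u *ℤ_) (*-distribˡ-sum (+ shuffles c (toℕ u)) λ i → G i (c + toℕ u)))
                       (*-distribˡ-sum (a u) λ i → + shuffles c (toℕ u) *ℤ G i (c + toℕ u))

⊛-coeff-- : ∀ {d} (a b : Vector ℤ d) F → (λ u → a u -ℤ b u) ⊛ F ≗ λ c → (a ⊛ F) c -ℤ (b ⊛ F) c
⊛-coeff-- a b F c =
  trans (sum-cong-≗ λ u → distrib (a u) (b u) ((+ shuffles c (toℕ u)) *ℤ F (c + toℕ u)))
        (trans (∑-distrib-+ (summand a F c) (λ u → -ℤ summand b F c u)) (cong ((a ⊛ F) c +ℤ_) (∑-neg (summand b F c))))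
  where distrib : ∀ x y m → (x -ℤ y) *ℤ m ≡ x *ℤ m +ℤ -ℤ (y *ℤ m)
        distrib = solve-∀

-- Multiplication of polynomials is commutative: ⊛ operators commute.  The
-- structure constants agree because shuffles are associative (shuffles-swap).
⊛-comm : ∀ {d e} (a : Vector ℤ d) (b : Vector ℤ e) F → a ⊛ (b ⊛ F) ≗ b ⊛ (a ⊛ F)
⊛-comm {d} {e} a b F c = begin
  (a ⊛ (b ⊛ F)) c                                                ≡⟨ expand a b ⟩
  ∑[ u < d ] ∑[ v < e ] term (toℕ u) (toℕ v) (a u) (b v)         ≡⟨ ∑-comm (λ u v → term (toℕ u) (toℕ v) (a u) (b v)) ⟩
  ∑[ v < e ] ∑[ u < d ] term (toℕ u) (toℕ v) (a u) (b v)         ≡⟨ sum-cong-≗ (λ v → sum-cong-≗ λ u → symmetric (toℕ u) (toℕ v) (a u) (b v)) ⟩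
  ∑[ v < e ] ∑[ u < d ] term (toℕ v) (toℕ u) (b v) (a u)         ≡⟨ expand b a ⟨
  (b ⊛ (a ⊛ F)) c                                                ∎
  where
  open ≡-Reasoning
  term : ℕ → ℕ → ℤ → ℤ → ℤ
  term u v x y = x *ℤ y *ℤ + (shuffles c u * shuffles (c + u) v) *ℤ F (c + u + v)
  regroup : ∀ x s y t f → x *ℤ (s *ℤ (y *ℤ (t *ℤ f))) ≡ x *ℤ y *ℤ (s *ℤ t) *ℤ f
  regroup = solve-∀
  expand : ∀ {d e} (a : Vector ℤ d) (b : Vector ℤ e) →
           (a ⊛ (b ⊛ F)) c ≡ ∑[ u < d ] ∑[ v < e ] term (toℕ u) (toℕ v) (a u) (b v)
  expand a b = sum-cong-≗ λ u → let s = + shuffles c (toℕ u) in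
    trans (cong (a u *ℤ_) (*-distribˡ-sum s (λ v → b v *ℤ (+ shuffles (c + toℕ u) (toℕ v) *ℤ F (c + toℕ u + toℕ v)))))
    (trans (*-distribˡ-sum (a u) (λ v → s *ℤ (b v *ℤ (+ shuffles (c + toℕ u) (toℕ v) *ℤ F (c + toℕ u + toℕ v)))))
    (sum-cong-≗ λ v → trans (regroup (a u) s (b v) (+ shuffles (c + toℕ u) (toℕ v)) (F (c + toℕ u + toℕ v)))
      (cong (λ m → a u *ℤ b v *ℤ m *ℤ F (c + toℕ u + toℕ v)) (sym (ℤP.pos-* (shuffles c (toℕ u)) _)))))
  symmetric : ∀ u v x y → term u v x y ≡ term v u y x
  symmetric u v x y = cong₂ (λ m f → m *ℤ f) (cong₂ (λ p s → p *ℤ + s) (ℤP.*-comm x y) (shuffles-swap c u v))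
                                             (cong F (exchange c u v))
    where exchange : ∀ c u v → c + u + v ≡ c + v + u
          exchange = ℕ-solve

-- Shift and point mass:  prev F c = φ((x⁽ᶜ⁾)′ G) = F (c − 1) (and 0 for
-- c = 0), and δ K is c ↦ [c = 0]·K.
prev : Seq → Seq
prev F zero    = + 0
prev F (suc c) = F c

δ : ℤ → Seq
δ K zero    = K
δ K (suc c) = + 0

-- Leibniz rule (x⁽ᶜ⁾ p)′ = x⁽ᶜ⁻¹⁾ p + x⁽ᶜ⁾ p′, paired with G under φ;
-- the derivative p′ has coefficient vector tail a.
⊛-prev : ∀ {d} (a : Vector ℤ (suc d)) F → a ⊛ prev F ≗ λ c → prev (a ⊛ F) c +ℤ (tail a ⊛ F) c
⊛-prev a F zero = cong₂ _+ℤ_ (ℤP.*-zeroʳ (a zero))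
  (sum-cong-≗ λ u → cong (λ s → a (suc u) *ℤ (+ s *ℤ F (toℕ u))) (sym (shuffles-zeroˡ (toℕ u))))
⊛-prev a F (suc c) = trans (cong (summand a F c zero +ℤ_)
                                 (trans (sum-cong-≗ split) (∑-distrib-+ (tail (summand a F c)) (summand (tail a) F (suc c)))))
                           (sym (ℤP.+-assoc (summand a F c zero) (sum (tail (summand a F c))) _))
  where
  split : ∀ u → summand a (prev F) (suc c) (suc u) ≡ summand a F c (suc u) +ℤ summand (tail a) F (suc c) u
  split u = trans (cong (λ s → a (suc u) *ℤ (s *ℤ F (c + suc (toℕ u)))) (ℤP.pos-+ (shuffles c (suc (toℕ u))) _))
            (trans (distrib (a (suc u)) (+ shuffles c (suc (toℕ u))) (+ shuffles (suc c) (toℕ u)) (F (c + suc (toℕ u))))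
            (cong (λ m → summand a F c (suc u) +ℤ a (suc u) *ℤ (+ shuffles (suc c) (toℕ u) *ℤ F m)) (ℕP.+-suc c (toℕ u))))
    where distrib : ∀ x s t f → x *ℤ ((s +ℤ t) *ℤ f) ≡ x *ℤ (s *ℤ f) +ℤ x *ℤ (t *ℤ f)
          distrib = solve-∀

⊛-δ : ∀ {d} (a : Vector ℤ (suc d)) K → a ⊛ δ K ≗ δ (head a *ℤ K)
⊛-δ {d} a K zero = trans (cong₂ _+ℤ_ (cong (a zero *ℤ_) (ℤP.*-identityˡ K)) (vanishes λ u → + shuffles 0 (suc (toℕ u))))
                     (ℤP.+-identityʳ _)
  where
  vanishes : (s : Vector ℤ d) → ∑[ u < d ] (a (suc u) *ℤ (s u *ℤ + 0)) ≡ + 0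
  vanishes s = trans (sum-cong-≗ λ u → trans (cong (a (suc u) *ℤ_) (ℤP.*-zeroʳ (s u))) (ℤP.*-zeroʳ (a (suc u))))
                     (sum-replicate-zero d)
⊛-δ {d} a K (suc c) = trans (sum-cong-≗ λ u → trans (cong (a u *ℤ_) (ℤP.*-zeroʳ (+ shuffles (suc c) (toℕ u)))) (ℤP.*-zeroʳ (a u)))
                        (sum-replicate-zero (suc d))

⊛-init-last : ∀ {d} (a : Vector ℤ (suc d)) F c →
              (a ⊛ F) c ≡ (init a ⊛ F) c +ℤ last a *ℤ (+ shuffles c d *ℤ F (c + d))
⊛-init-last {d} a F c = trans (sum-init-last (summand a F c)) (cong₂ _+ℤ_
  (sum-cong-≗ λ u → cong (λ m → a (inject₁ u) *ℤ (+ shuffles c m *ℤ F (c + m))) (FinP.toℕ-inject₁ u))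
  (cong (λ m → last a *ℤ (+ shuffles c m *ℤ F (c + m))) (FinP.toℕ-fromℕ d)))

-- The factor of a letter owning t positions of the base word and q copies
-- still to be placed:  f_{t,q} = Σ_{j ≤ q} (−1)ʲ C(t,j) x⁽q−j⁾, where j
-- counts copies forced onto the letter's own positions (inclusion–exclusion);
-- coefficients are indexed by the exponent u = q − j.
factor : ℕ → (q : ℕ) → Vector ℤ (suc q)
factor t q u = -1ℤ ^ℤ (q ∸ toℕ u) *ℤ + binom t (q ∸ toℕ u)

factor-top : ∀ t q → last (factor t q) ≡ + 1
factor-top t q rewrite FinP.toℕ-fromℕ q | ℕP.n∸n≡0 q = refl

-- Pascal's rule  f_{t+1,q} = f_{t,q} − f′_{t,q};  note f′_{t,q+1} = f_{t,q}
-- holds definitionally (tail (factor t (suc q)) is factor t q).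
factor-pascal : ∀ t q F → factor (suc t) q ⊛ F ≗ λ c → (factor t q ⊛ F) c -ℤ (tail (factor t q) ⊛ F) c
factor-pascal t zero    F c = sym (ℤP.+-identityʳ _)
factor-pascal t (suc q) F c = begin
  (factor (suc t) (suc q) ⊛ F) c
    ≡⟨ ⊛-init-last (factor (suc t) (suc q)) F c ⟩
  (init (factor (suc t) (suc q)) ⊛ F) c +ℤ last (factor (suc t) (suc q)) *ℤ top
    ≡⟨ cong₂ (λ x y → x +ℤ y *ℤ top) (trans (⊛-coeff-cong coefficients F c) (⊛-coeff-- (init (factor t (suc q))) (factor t q) F c))
                                      (trans (factor-top (suc t) (suc q)) (sym (factor-top t (suc q)))) ⟩
  (init (factor t (suc q)) ⊛ F) c -ℤ (factor t q ⊛ F) c +ℤ last (factor t (suc q)) *ℤ top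
    ≡⟨ swap ((init (factor t (suc q)) ⊛ F) c) ((factor t q ⊛ F) c) (last (factor t (suc q)) *ℤ top) ⟩
  (init (factor t (suc q)) ⊛ F) c +ℤ last (factor t (suc q)) *ℤ top -ℤ (factor t q ⊛ F) c
    ≡⟨ cong (_-ℤ (factor t q ⊛ F) c) (⊛-init-last (factor t (suc q)) F c) ⟨
  (factor t (suc q) ⊛ F) c -ℤ (factor t q ⊛ F) c
    ∎
  where
  open ≡-Reasoning
  top = + shuffles c (suc q) *ℤ F (c + suc q)
  swap : ∀ x y z → x -ℤ y +ℤ z ≡ x +ℤ z -ℤ y
  swap = solve-∀
  pascal : ∀ m → -1ℤ ^ℤ suc m *ℤ + binom (suc t) (suc m) ≡ -1ℤ ^ℤ suc m *ℤ + binom t (suc m) -ℤ -1ℤ ^ℤ m *ℤ + binom t m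
  pascal m = trans (cong (-1ℤ ^ℤ suc m *ℤ_) (ℤP.pos-+ (binom t m) _))
                   (expand (-1ℤ ^ℤ m) (+ binom t m) (+ binom t (suc m)))
    where expand : ∀ s x y → -1ℤ *ℤ s *ℤ (x +ℤ y) ≡ -1ℤ *ℤ s *ℤ y -ℤ s *ℤ x
          expand = solve-∀
  coefficients : ∀ u → init (factor (suc t) (suc q)) u ≡ init (factor t (suc q)) u -ℤ factor t q u
  coefficients u = trans (cong (λ m → -1ℤ ^ℤ m *ℤ + binom (suc t) m) below)
                  (trans (pascal (q ∸ toℕ u))
                         (cong (λ m → -1ℤ ^ℤ m *ℤ + binom t m -ℤ factor t q u) (sym below)))
    where below : suc q ∸ toℕ (inject₁ u) ≡ suc (q ∸ toℕ u)
          below = trans (cong (suc q ∸_) (FinP.toℕ-inject₁ u)) (ℕP.+-∸-assoc 1 (FinP.toℕ≤pred[n] u))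

-- F is the moment sequence of some G with G(0) = K whose derivative G′ has
-- moment sequence D: the integration by parts φ(H) = H(0) + φ(H′), applied to
-- H = x⁽ᶜ⁾ G, reads  F c = [c = 0]·K + F (c − 1) + D c.
HasDerivative : ℤ → Seq → Seq → Set
HasDerivative K D F = ∀ c → F c ≡ δ K c +ℤ prev F c +ℤ D c

HasDerivative-resp : ∀ {K K′ D D′ F} → K ≡ K′ → D ≗ D′ → HasDerivative K D F → HasDerivative K′ D′ F
HasDerivative-resp {F = F} K≡K′ D≗D′ F-rec c =
  trans (F-rec c) (cong₂ (λ k d → δ k c +ℤ prev F c +ℤ d) K≡K′ (D≗D′ c))

one : Seq
one _ = + 1

one-derivative : HasDerivative (+ 1) (λ _ → + 0) one
one-derivative zero    = refl
one-derivative (suc c) = refl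

-- Leibniz rule for p · G:  (p G)(0) = p(0) G(0)  and  (p G)′ = p G′ + p′ G.
⊛-derivative : ∀ {d} (a : Vector ℤ (suc d)) {K D F} → HasDerivative K D F →
               HasDerivative (head a *ℤ K) (λ c → (a ⊛ D) c +ℤ (tail a ⊛ F) c) (a ⊛ F)
⊛-derivative a {K} {D} {F} F-rec c = begin
  (a ⊛ F) c
    ≡⟨ ⊛-cong a F-rec c ⟩
  (a ⊛ (λ e → δ K e +ℤ prev F e +ℤ D e)) c
    ≡⟨ ⊛-+ a (λ e → δ K e +ℤ prev F e) D c ⟩
  (a ⊛ (λ e → δ K e +ℤ prev F e)) c +ℤ (a ⊛ D) c
    ≡⟨ cong (_+ℤ (a ⊛ D) c) (⊛-+ a (δ K) (prev F) c) ⟩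
  (a ⊛ δ K) c +ℤ (a ⊛ prev F) c +ℤ (a ⊛ D) c
    ≡⟨ cong₂ (λ x y → x +ℤ y +ℤ (a ⊛ D) c) (⊛-δ a K c) (⊛-prev a F c) ⟩
  δ (head a *ℤ K) c +ℤ (prev (a ⊛ F) c +ℤ (tail a ⊛ F) c) +ℤ (a ⊛ D) c
    ≡⟨ regroup (δ (head a *ℤ K) c) (prev (a ⊛ F) c) ((tail a ⊛ F) c) ((a ⊛ D) c) ⟩
  δ (head a *ℤ K) c +ℤ prev (a ⊛ F) c +ℤ ((a ⊛ D) c +ℤ (tail a ⊛ F) c)
    ∎
  where
  open ≡-Reasoning
  regroup : ∀ k p t d → k +ℤ (p +ℤ t) +ℤ d ≡ k +ℤ p +ℤ (d +ℤ t)
  regroup = solve-∀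

-- The moment sequence of the product Π_{i<r} f_{T_i,Q_i}: its value at
-- c = 0 is the inclusion–exclusion count of words with Q_i copies of letter i
-- avoiding the T_i positions of letter i.
moments : (r : ℕ) → (T Q : Vector ℕ r) → Seq
moments zero    T Q = one
moments (suc r) T Q = factor (head T) (head Q) ⊛ moments r (tail T) (tail Q)

atZero : (r : ℕ) → (T Q : Vector ℕ r) → ℤ
atZero zero    T Q = + 1
atZero (suc r) T Q = head (factor (head T) (head Q)) *ℤ atZero r (tail T) (tail Q)

-- The moment sequence of the product with the a-th factor differentiated.
partial : (r : ℕ) → (T Q : Vector ℕ r) → Fin r → Seq
partial (suc r) T Q zero    = tail (factor (head T) (head Q)) ⊛ moments r (tail T) (tail Q)
partial (suc r) T Q (suc a) = factor (head T) (head Q) ⊛ partial r (tail T) (tail Q) a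

moments-derivative : ∀ r T Q → HasDerivative (atZero r T Q) (λ c → ∑[ a < r ] partial r T Q a c) (moments r T Q)
moments-derivative zero    T Q = one-derivative
moments-derivative (suc r) T Q =
  HasDerivative-resp refl product-rule (⊛-derivative f (moments-derivative r (tail T) (tail Q)))
  where
  f = factor (head T) (head Q)
  product-rule : ∀ c → (f ⊛ (λ e → ∑[ a < r ] partial r (tail T) (tail Q) a e)) c +ℤ (tail f ⊛ moments r (tail T) (tail Q)) c
                     ≡ ∑[ a < suc r ] partial (suc r) T Q a c
  product-rule c = trans (cong (_+ℤ derivative) (⊛-∑ f (partial r (tail T) (tail Q)) c))
                         (ℤP.+-comm (∑[ a < r ] (f ⊛ partial r (tail T) (tail Q) a) c) derivative)
    where derivative = (tail f ⊛ moments r (tail T) (tail Q)) c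

ifPositive : ℕ → ℤ → ℤ
ifPositive zero    x = + 0
ifPositive (suc _) x = x

factor-derivative : ∀ t q F c → (tail (factor t q) ⊛ F) c ≡ ifPositive q ((factor t (pred q) ⊛ F) c)
factor-derivative t zero    F c = refl
factor-derivative t (suc q) F c = refl

⊛-ifPositive : ∀ {d} (a : Vector ℤ d) q F c → (a ⊛ (λ e → ifPositive q (F e))) c ≡ ifPositive q ((a ⊛ F) c)
⊛-ifPositive a zero    F c = ⊛-∑ {r = 0} a (λ ()) c
⊛-ifPositive a (suc q) F c = refl

partial-lowers : ∀ r T Q a → partial r T Q a ≗ λ c → ifPositive (Q a) (moments r T (updateAt Q a pred) c)
partial-lowers (suc r) T Q zero    c = factor-derivative (head T) (head Q) (moments r (tail T) (tail Q)) c
partial-lowers (suc r) T Q (suc a) c =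
  trans (⊛-cong f (partial-lowers r (tail T) (tail Q) a) c)
        (⊛-ifPositive f (Q (suc a)) (moments r (tail T) (updateAt (tail Q) a pred)) c)
  where f = factor (head T) (head Q)

-- One more position for letter b: by Pascal's rule the b-th factor loses its derivative.
moments-pascal : ∀ r T Q b → moments r (updateAt T b suc) Q ≗ λ c → moments r T Q c -ℤ partial r T Q b c
moments-pascal (suc r) T Q zero    c = factor-pascal (head T) (head Q) (moments r (tail T) (tail Q)) c
moments-pascal (suc r) T Q (suc b) c =
  trans (⊛-cong f (moments-pascal r (tail T) (tail Q) b) c)
        (⊛-- f (moments r (tail T) (tail Q)) (partial r (tail T) (tail Q) b) c)
  where f = factor (head T) (head Q)

moments-cong : ∀ r {T T′ Q Q′} → T ≗ T′ → Q ≗ Q′ → moments r T Q ≗ moments r T′ Q′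
moments-cong zero    T≗T′ Q≗Q′ c = refl
moments-cong (suc r) {T} {T′} {Q} {Q′} T≗T′ Q≗Q′ c =
  trans (cong₂ (λ t q → (factor t q ⊛ moments r (tail T) (tail Q)) c) (T≗T′ zero) (Q≗Q′ zero))
        (⊛-cong (factor (T′ zero) (Q′ zero)) (moments-cong r (λ i → T≗T′ (suc i)) (λ i → Q≗Q′ (suc i))) c)

moments-empty : ∀ r → moments r (λ _ → 0) (λ _ → 0) ≗ one
moments-empty zero    c = refl
moments-empty (suc r) c = cong (λ x → + 1 *ℤ (+ 1 *ℤ x) +ℤ + 0) (moments-empty r (c + 0))

-- If fewer positions than letters remain, some Q_i > T_i and the product vanishes at 0.
atZero-vanishes : ∀ r T Q → ℕΣ.sum T < ℕΣ.sum Q → atZero r T Q ≡ + 0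
atZero-vanishes zero    T Q ()
atZero-vanishes (suc r) T Q ΣT<ΣQ with ℕP.≤-<-connex (head Q) (head T)
... | inj₂ t<q = begin
  -1ℤ ^ℤ head Q *ℤ + binom (head T) (head Q) *ℤ rest   ≡⟨ cong (λ b → -1ℤ ^ℤ head Q *ℤ + b *ℤ rest) (binom-above t<q) ⟩
  -1ℤ ^ℤ head Q *ℤ + 0 *ℤ rest                          ≡⟨ cong (_*ℤ rest) (ℤP.*-zeroʳ (-1ℤ ^ℤ head Q)) ⟩
  + 0 *ℤ rest                                            ≡⟨ ℤP.*-zeroˡ rest ⟩
  + 0                                                    ∎
  where open ≡-Reasoning
        rest = atZero r (tail T) (tail Q)
... | inj₁ q≤t = trans (cong (head (factor (head T) (head Q)) *ℤ_) (atZero-vanishes r (tail T) (tail Q) tails))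
                       (ℤP.*-zeroʳ (head (factor (head T) (head Q))))
  where tails = ℕP.+-cancelˡ-< (head Q) _ _ (ℕP.≤-<-trans (ℕP.+-monoˡ-≤ (ℕΣ.sum (tail T)) q≤t) ΣT<ΣQ)

power : ∀ {d} → Vector ℤ d → ℕ → Seq → Seq
power a zero    F = F
power a (suc n) F = a ⊛ power a n F

power-cong : ∀ {d} (a : Vector ℤ d) n {F G} → F ≗ G → power a n F ≗ power a n G
power-cong a zero    F≗G = F≗G
power-cong a (suc n) F≗G = ⊛-cong a (power-cong a n F≗G)

power-∑ : ∀ {d r} (a : Vector ℤ d) n (G : Fin r → Seq) →
          power a n (λ e → ∑[ i < r ] G i e) ≗ λ c → ∑[ i < r ] power a n (G i) c
power-∑ a zero    G c = refl
power-∑ a (suc n) G c = trans (⊛-cong a (power-∑ a n G) c) (⊛-∑ a (λ i → power a n (G i)) c)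

-- Leibniz rule for pⁿ G:  (pⁿ G)′ = pⁿ G′ + n · p′ pⁿ⁻¹ G,  since the
-- factors commute.  The second term is a multiple of n.
power-derivative : ∀ {d} (a : Vector ℤ (suc d)) n {K D F} → HasDerivative K D F →
  HasDerivative (head a ^ℤ n *ℤ K) (λ c → power a n D c +ℤ + n *ℤ (tail a ⊛ power a (pred n) F) c) (power a n F)
power-derivative a zero {K} {D} {F} F-rec =
  HasDerivative-resp (sym (ℤP.*-identityˡ K)) (λ c → sym (no-correction c)) F-rec
  where no-correction : ∀ c → D c +ℤ + 0 *ℤ (tail a ⊛ F) c ≡ D c
        no-correction c = trans (cong (D c +ℤ_) (ℤP.*-zeroˡ ((tail a ⊛ F) c))) (ℤP.+-identityʳ (D c))
power-derivative a (suc n) {K} {D} {F} F-rec =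
  HasDerivative-resp (sym (ℤP.*-assoc (head a) (head a ^ℤ n) K)) collect
                     (⊛-derivative a (power-derivative a n F-rec))
  where
  open ≡-Reasoning
  W = tail a ⊛ power a n F
  -- p · p′ pⁿ⁻¹ G = p′ pⁿ G  (multiplication commutes; vacuous when n = 0)
  commute : ∀ n c → + n *ℤ (a ⊛ (tail a ⊛ power a (pred n) F)) c ≡ + n *ℤ (tail a ⊛ power a n F) c
  commute zero    c = trans (ℤP.*-zeroˡ ((a ⊛ (tail a ⊛ F)) c)) (sym (ℤP.*-zeroˡ ((tail a ⊛ F) c)))
  commute (suc n) c = cong (+ suc n *ℤ_) (⊛-comm a (tail a) (power a n F) c)
  collect : ∀ c → (a ⊛ (λ e → power a n D e +ℤ + n *ℤ (tail a ⊛ power a (pred n) F) e)) c +ℤ W c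
                ≡ power a (suc n) D c +ℤ + suc n *ℤ W c
  collect c = begin
    (a ⊛ (λ e → power a n D e +ℤ + n *ℤ (tail a ⊛ power a (pred n) F) e)) c +ℤ W c
      ≡⟨ cong (_+ℤ W c) (⊛-+ a (power a n D) (λ e → + n *ℤ (tail a ⊛ power a (pred n) F) e) c) ⟩
    power a (suc n) D c +ℤ (a ⊛ (λ e → + n *ℤ (tail a ⊛ power a (pred n) F) e)) c +ℤ W c
      ≡⟨ cong (λ x → power a (suc n) D c +ℤ x +ℤ W c) (trans (⊛-scale a (+ n) (tail a ⊛ power a (pred n) F) c) (commute n c)) ⟩
    power a (suc n) D c +ℤ + n *ℤ W c +ℤ W c
      ≡⟨ one-more (power a (suc n) D c) (+ n) (W c) ⟩
    power a (suc n) D c +ℤ (+ 1 +ℤ + n) *ℤ W c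
      ≡⟨ cong (λ m → power a (suc n) D c +ℤ m *ℤ W c) (ℤP.pos-+ 1 n) ⟨
    power a (suc n) D c +ℤ + suc n *ℤ W c
      ∎
    where one-more : ∀ x m w → x +ℤ m *ℤ w +ℤ w ≡ x +ℤ (+ 1 +ℤ m) *ℤ w
          one-more = solve-∀

-- The recursion F c = [c = 0]·K + F (c − 1) + D c determines F linearly
-- from (K, D); hence congruences between the data pass to the sequences.
derivative-congruence : ∀ {n} ρ {K K′ D D′ F F′} → HasDerivative K D F → HasDerivative K′ D′ F′ →
  K′ ≡ ρ *ℤ K [mod n ] → (∀ c → D′ c ≡ ρ *ℤ D c [mod n ]) → ∀ c → F′ c ≡ ρ *ℤ F c [mod n ]
derivative-congruence {n} ρ {K} {K′} {D} {D′} {F} {F′} F-rec F′-rec K′≡ρK D′≡ρD c = begin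
  F′ c                                        ≡⟨ F′-rec c ⟩
  δ K′ c +ℤ prev F′ c +ℤ D′ c                 ≈⟨ mod-+ (mod-+ (at-zero c) (earlier c)) (D′≡ρD c) ⟩
  ρ *ℤ δ K c +ℤ ρ *ℤ prev F c +ℤ ρ *ℤ D c    ≡⟨ factor-out ρ (δ K c) (prev F c) (D c) ⟩
  ρ *ℤ (δ K c +ℤ prev F c +ℤ D c)             ≡⟨ cong (ρ *ℤ_) (F-rec c) ⟨
  ρ *ℤ F c                                    ∎
  where
  open SetoidReasoning (modSetoid {n})
  factor-out : ∀ ρ k p d → ρ *ℤ k +ℤ ρ *ℤ p +ℤ ρ *ℤ d ≡ ρ *ℤ (k +ℤ p +ℤ d)
  factor-out = solve-∀
  at-zero : ∀ c → δ K′ c ≡ ρ *ℤ δ K c [mod n ]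
  at-zero zero    = K′≡ρK
  at-zero (suc c) = ≡⇒≡mod (sym (ℤP.*-zeroʳ ρ))
  earlier : ∀ c → prev F′ c ≡ ρ *ℤ prev F c [mod n ]
  earlier zero    = ≡⇒≡mod (sym (ℤP.*-zeroʳ ρ))
  earlier (suc c) = derivative-congruence ρ F-rec F′-rec K′≡ρK D′≡ρD c

-- The Leibniz correction
-- n · p′pⁿ⁻¹G vanishes mod n, and G′ is a sum of products with one letter
-- fewer to place, so induction on Σ Q applies.
power-moments : ∀ {d} (a : Vector ℤ (suc d)) n r T Q c →
                power a n (moments r T Q) c ≡ head a ^ℤ n *ℤ moments r T Q c [mod n ]
power-moments a n r T Q = <-rec Claim step (ℕΣ.sum Q) Q refl
  where
  ρ = head a ^ℤ n
  Claim : ℕ → Set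
  Claim s = ∀ Q → ℕΣ.sum Q ≡ s → ∀ c → power a n (moments r T Q) c ≡ ρ *ℤ moments r T Q c [mod n ]
  step : ∀ s → (∀ {s′} → s′ < s → Claim s′) → Claim s
  step s induction Q ΣQ≡s =
    derivative-congruence ρ (moments-derivative r T Q) (power-derivative a n (moments-derivative r T Q))
                          (≡⇒≡mod refl) derivatives
    where
    open SetoidReasoning (modSetoid {n})
    lowered : ∀ b c → power a n (partial r T Q b) c ≡ ρ *ℤ partial r T Q b c [mod n ]
    lowered b c = begin
      power a n (partial r T Q b) c                   ≡⟨ power-cong a n (partial-lowers r T Q b) c ⟩
      power a n (λ e → ifPositive (Q b) (Mb e)) c     ≈⟨ by-cases (Q b) refl ⟩
      ρ *ℤ ifPositive (Q b) (Mb c)                     ≡⟨ cong (ρ *ℤ_) (partial-lowers r T Q b c) ⟨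
      ρ *ℤ partial r T Q b c                           ∎
      where
      Mb = moments r T (updateAt Q b pred)
      by-cases : ∀ x → Q b ≡ x → power a n (λ e → ifPositive x (Mb e)) c ≡ ρ *ℤ ifPositive x (Mb c) [mod n ]
      by-cases zero    _      = ≡⇒≡mod (trans (power-∑ {r = 0} a n (λ ()) c) (sym (ℤP.*-zeroʳ ρ)))
      by-cases (suc q) Qb≡1+q = induction (ℕP.≤-reflexive (trans (sum-lower Q b Qb≡1+q) ΣQ≡s))
                                          (updateAt Q b pred) refl c
    derivatives : ∀ c → power a n (λ e → ∑[ b < r ] partial r T Q b e) c +ℤ + n *ℤ (tail a ⊛ power a (pred n) (moments r T Q)) c
                        ≡ ρ *ℤ ∑[ b < r ] partial r T Q b c [mod n ]
    derivatives c = begin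
      power a n (λ e → ∑[ b < r ] partial r T Q b e) c +ℤ + n *ℤ (tail a ⊛ power a (pred n) (moments r T Q)) c
        ≈⟨ mod-+-multiple _ _ ⟩
      power a n (λ e → ∑[ b < r ] partial r T Q b e) c
        ≡⟨ power-∑ a n (partial r T Q) c ⟩
      ∑[ b < r ] power a n (partial r T Q b) c
        ≈⟨ mod-∑ (λ b → lowered b c) ⟩
      ∑[ b < r ] (ρ *ℤ partial r T Q b c)
        ≡⟨ *-distribˡ-sum ρ (λ b → partial r T Q b c) ⟨
      ρ *ℤ ∑[ b < r ] partial r T Q b c
        ∎

all-letters⁺ : ∀ {r} {P : Fin r → Set} → (∀ a → P a) → All P (toList (allFin r))
all-letters⁺ P-all = VecAll.toList⁺ (VecAll.tabulate⁺ P-all)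

all-letters⁻ : ∀ {r} {P : Fin r → Set} → All P (toList (allFin r)) → ∀ a → P a
all-letters⁻ P-all = VecAll.tabulate⁻ (VecAll.toList⁻ P-all)

count-concatMap : ∀ {A B : Set} {P : B → Set} (P? : Decidable P) (f : A → List B) {r} (g : Fin r → A) →
  length (filter P? (concatMap f (toList (tabulate g)))) ≡ ℕΣ.sum (λ i → length (filter P? (f (g i))))
count-concatMap P? f {zero}  g = refl
count-concatMap P? f {suc r} g = begin
  length (filter P? (f (g zero) ++ rest))                  ≡⟨ cong length (LP.filter-++ P? (f (g zero)) rest) ⟩
  length (filter P? (f (g zero)) ++ filter P? rest)         ≡⟨ LP.length-++ (filter P? (f (g zero))) ⟩
  length (filter P? (f (g zero))) + length (filter P? rest)           ≡⟨ cong (λ m → length (filter P? (f (g zero))) + m) (count-concatMap P? f (g ∘ suc)) ⟩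
  ℕΣ.sum (λ i → length (filter P? (f (g i))))                         ∎
  where open ≡-Reasoning
        rest = concatMap f (toList (tabulate (g ∘ suc)))

count-map : ∀ {A B : Set} {P : B → Set} (P? : Decidable P) (f : A → B) xs →
            length (filter P? (map f xs)) ≡ length (filter (P? ∘ f) xs)
count-map P? f []       = refl
count-map P? f (x ∷ xs) with does (P? (f x))
... | true  = cong suc (count-map P? f xs)
... | false = count-map P? f xs

occ-here : ∀ {r} (a : Fin r) w → occ a (a ∷ w) ≡ suc (occ a w)
occ-here a w = cong length (LP.filter-accept (a ≟ᶠ_) refl)

occ-there : ∀ {r} {a b : Fin r} w → ¬ a ≡ b → occ a (b ∷ w) ≡ occ a w
occ-there {a = a} w a≢b = cong length (LP.filter-reject (a ≟ᶠ_) a≢b)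

occ-cons : ∀ {r} (b : Fin r) w → (λ a → occ a (b ∷ w)) ≗ updateAt (λ a → occ a w) b suc
occ-cons b w a = by-cases (a ≟ᶠ b)
  where
  by-cases : Dec (a ≡ b) → occ a (b ∷ w) ≡ updateAt (λ c → occ c w) b suc a
  by-cases (yes refl) = trans (occ-here a w) (sym (updateAt-updates a (λ c → occ c w)))
  by-cases (no a≢b)   = trans (occ-there w a≢b) (sym (updateAt-minimal a b (λ c → occ c w) a≢b))

sum-occ : ∀ {r} (u : List (Fin r)) → ℕΣ.sum (λ a → occ a u) ≡ length u
sum-occ {r}     []      = ℕΣ.sum-replicate-zero r
sum-occ {suc r} (b ∷ u) = begin
  ℕΣ.sum (λ a → occ a (b ∷ u))                          ≡⟨ ℕΣ.sum-cong-≗ (occ-cons b u) ⟩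
  ℕΣ.sum (updateAt T b suc)                             ≡⟨ sum-updateAt T b suc ⟩
  suc (T b + ℕΣ.sum (removeAt T b))                      ≡⟨ cong suc (ℕΣ.sum-remove {i = b} T) ⟨
  suc (ℕΣ.sum T)                                        ≡⟨ cong suc (sum-occ u) ⟩
  suc (length u)                                        ∎
  where open ≡-Reasoning
        T = λ a → occ a u

Matches : ∀ {r} → List (Fin r) → Vector ℕ r → Set
Matches {r} w Q = All (λ a → occ a w ≡ Q a) (toList (allFin r))

matches? : ∀ {r} (w : List (Fin r)) Q → Dec (Matches w Q)
matches? {r} w Q = All.all? (λ a → occ a w ℕP.≟ Q a) (toList (allFin r))

matches-tail⁻ : ∀ {r} (Q : Vector ℕ r) a w → Matches (a ∷ w) Q → Matches w (updateAt Q a pred)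
matches-tail⁻ Q a w m = all-letters⁺ λ c → letter c (all-letters⁻ m c)
  where
  letter : ∀ c → occ c (a ∷ w) ≡ Q c → occ c w ≡ updateAt Q a pred c
  letter c = by-cases (c ≟ᶠ a)
    where
    by-cases : Dec (c ≡ a) → occ c (a ∷ w) ≡ Q c → occ c w ≡ updateAt Q a pred c
    by-cases (yes refl) eq = trans (cong pred (trans (sym (occ-here c w)) eq)) (sym (updateAt-updates c Q))
    by-cases (no c≢a)   eq = trans (sym (occ-there w c≢a)) (trans eq (sym (updateAt-minimal c a Q c≢a)))

matches-tail⁺ : ∀ {r} (Q : Vector ℕ r) a w {q} → Q a ≡ suc q → Matches w (updateAt Q a pred) → Matches (a ∷ w) Q
matches-tail⁺ Q a w {q} Qa≡1+q m = all-letters⁺ λ c → letter c (all-letters⁻ m c)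
  where
  letter : ∀ c → occ c w ≡ updateAt Q a pred c → occ c (a ∷ w) ≡ Q c
  letter c = by-cases (c ≟ᶠ a)
    where
    open ≡-Reasoning
    by-cases : Dec (c ≡ a) → occ c w ≡ updateAt Q a pred c → occ c (a ∷ w) ≡ Q c
    by-cases (yes refl) eq = begin
      occ c (c ∷ w)               ≡⟨ occ-here c w ⟩
      suc (occ c w)               ≡⟨ cong suc (trans eq (updateAt-updates c Q)) ⟩
      suc (pred (Q c))            ≡⟨ cong (λ (x : ℕ) → suc (pred x)) Qa≡1+q ⟩
      suc q                       ≡⟨ Qa≡1+q ⟨
      Q c                         ∎
    by-cases (no c≢a)   eq = trans (occ-there w c≢a) (trans eq (updateAt-minimal c a Q c≢a))

matches-no-room : ∀ {r} (Q : Vector ℕ r) a w → Q a ≡ 0 → ¬ Matches (a ∷ w) Q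
matches-no-room Q a w Qa≡0 m with trans (sym (occ-here a w)) (trans (all-letters⁻ m a) Qa≡0)
... | ()

derangements : ∀ {r} → List (Fin r) → Vector ℕ r → ℕ
derangements {r} u Q = length (filter (λ w → matches? w Q ×-dec noFixed? w u) (allWords r (length u)))

starting : ∀ {r} → List (Fin r) → Fin r → Vector ℕ r → Fin r → ℕ
starting {r} u b Q a = length (filter (λ w → matches? (a ∷ w) Q ×-dec noFixed? (a ∷ w) (b ∷ u)) (allWords r (length u)))

derangements-cons : ∀ {r} (u : List (Fin r)) b Q → derangements (b ∷ u) Q ≡ ℕΣ.sum (starting u b Q)
derangements-cons {r} u b Q =
  trans (count-concatMap P? (λ a → map (a ∷_) (allWords r (length u))) (λ a → a))
        (ℕΣ.sum-cong-≗ λ a → count-map P? (a ∷_) (allWords r (length u)))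
  where P? = λ w → matches? w Q ×-dec noFixed? w (b ∷ u)

starting-fixed : ∀ {r} (u : List (Fin r)) b Q → starting u b Q b ≡ 0
starting-fixed {r} u b Q = cong length (LP.filter-none P?
  (universal (λ { w (_ , (b≢b ∷ _)) → b≢b refl }) (allWords r (length u))))
  where P? = λ w → matches? (b ∷ w) Q ×-dec noFixed? (b ∷ w) (b ∷ u)

-- For a ≠ b the first position is fine and the rest is a smaller instance.
starting-free : ∀ {r} (u : List (Fin r)) b Q a → ¬ a ≡ b →
                + starting u b Q a ≡ ifPositive (Q a) (+ derangements u (updateAt Q a pred))
starting-free {r} u b Q a a≢b = by-cases (Q a) refl
  where
  ws = allWords r (length u)
  P? = λ w → matches? (a ∷ w) Q ×-dec noFixed? (a ∷ w) (b ∷ u)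
  by-cases : ∀ x → Q a ≡ x → + starting u b Q a ≡ ifPositive x (+ derangements u (updateAt Q a pred))
  by-cases zero    Qa≡0   = cong (λ l → + length l) (LP.filter-none P?
    (universal (λ { w (m , _) → matches-no-room Q a w Qa≡0 m }) ws))
  by-cases (suc q) Qa≡1+q = cong (λ l → + length l) (LP.filter-≐ P? (λ w → matches? w (updateAt Q a pred) ×-dec noFixed? w u)
    ( (λ { (m , (_ ∷ nf)) → matches-tail⁻ Q a _ m , nf })
    , (λ { (m , nf) → matches-tail⁺ Q a _ Qa≡1+q m , (a≢b ∷ nf) }) ) ws)

-- Both sides satisfy the same recursion
-- in the first letter b of u: the left by choosing the first letter a ≠ b,
-- the right by Pascal's rule for the b-th factor and the Leibniz rule.
derangements-moments : ∀ {r} (u : List (Fin r)) Q → ℕΣ.sum Q ≡ length u →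
                       + derangements u Q ≡ moments r (λ a → occ a u) Q 0
derangements-moments {r} [] Q ΣQ≡0 = begin
  + derangements [] Q                 ≡⟨ cong (λ l → + length l) (LP.filter-accept P? (all-letters⁺ (λ a → sym (Q≡0 a)) , [])) ⟩
  + 1                                 ≡⟨ moments-empty r 0 ⟨
  moments r (λ _ → 0) (λ _ → 0) 0     ≡⟨ moments-cong r (λ _ → refl) (λ a → sym (Q≡0 a)) 0 ⟩
  moments r (λ a → occ a []) Q 0      ∎
  where open ≡-Reasoning
        Q≡0 = sum-zero Q ΣQ≡0
        P? = λ w → matches? w Q ×-dec noFixed? w []
derangements-moments {suc r} (b ∷ u) Q ΣQ≡1+|u| = begin
  + derangements (b ∷ u) Q                                     ≡⟨ cong +_ (derangements-cons u b Q) ⟩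
  + ℕΣ.sum (starting u b Q)                                    ≡⟨ pos-sum (starting u b Q) ⟩
  ∑[ a < suc r ] (+ starting u b Q a)                          ≡⟨ sum-remove {i = b} (λ a → + starting u b Q a) ⟩
  + starting u b Q b +ℤ ∑[ i < r ] (+ starting u b Q (punchIn b i))
                                                               ≡⟨ cong (λ m → + m +ℤ ∑[ i < r ] (+ starting u b Q (punchIn b i))) (starting-fixed u b Q) ⟩
  + 0 +ℤ ∑[ i < r ] (+ starting u b Q (punchIn b i))           ≡⟨ ℤP.+-identityˡ (∑[ i < r ] (+ starting u b Q (punchIn b i))) ⟩
  ∑[ i < r ] (+ starting u b Q (punchIn b i))                  ≡⟨ sum-cong-≗ (λ i → other-letter (punchIn b i) (punchInᵢ≢i b i)) ⟩
  ∑[ i < r ] ∂ (punchIn b i)                                   ≡⟨ without-b ⟩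
  moments (suc r) T Q 0 -ℤ ∂ b                                 ≡⟨ moments-pascal (suc r) T Q b 0 ⟨
  moments (suc r) (updateAt T b suc) Q 0                       ≡⟨ moments-cong (suc r) {Q = Q} (occ-cons b u) (λ _ → refl) 0 ⟨
  moments (suc r) (λ a → occ a (b ∷ u)) Q 0                    ∎
  where
  open ≡-Reasoning
  T = λ a → occ a u
  ∂ = λ a → partial (suc r) T Q a 0
  other-letter : ∀ a → ¬ a ≡ b → + starting u b Q a ≡ ∂ a
  other-letter a a≢b = trans (starting-free u b Q a a≢b) (trans (smaller (Q a) refl) (sym (partial-lowers (suc r) T Q a 0)))
    where
    smaller : ∀ x → Q a ≡ x → ifPositive x (+ derangements u (updateAt Q a pred)) ≡ ifPositive x (moments (suc r) T (updateAt Q a pred) 0)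
    smaller zero    _      = refl
    smaller (suc q) Qa≡1+q = derangements-moments u (updateAt Q a pred) (ℕP.suc-injective (trans (sum-lower Q a Qa≡1+q) ΣQ≡1+|u|))
  -- Fewer positions than letters: the product vanishes at 0, so its 0-th
  -- moment is the 0-th moment of its derivative, Σ_a ∂ a.
  total : moments (suc r) T Q 0 ≡ ∑[ a < suc r ] ∂ a
  total = trans (moments-derivative (suc r) T Q 0)
    (trans (cong (λ k → k +ℤ + 0 +ℤ ∑[ a < suc r ] ∂ a) (atZero-vanishes (suc r) T Q fewer-positions)) (ℤP.+-identityˡ (∑[ a < suc r ] ∂ a)))
    where fewer-positions = subst₂ _<_ (sym (sum-occ u)) (sym ΣQ≡1+|u|) (ℕP.n<1+n (length u))
  without-b : ∑[ i < r ] ∂ (punchIn b i) ≡ moments (suc r) T Q 0 -ℤ ∂ b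
  without-b = isolate (trans total (sum-remove {i = b} ∂))
    where isolate : ∀ {x y z} → x ≡ y +ℤ z → z ≡ x -ℤ y
          isolate {x} {y} {z} refl = cancel y z
            where cancel : ∀ y z → z ≡ y +ℤ z -ℤ y
                  cancel = solve-∀

occ-replicate-same : ∀ {m} (a : Fin m) k → occ a (List.replicate k a) ≡ k
occ-replicate-same a zero    = refl
occ-replicate-same a (suc k) = trans (occ-here a _) (cong suc (occ-replicate-same a k))

occ-replicate-other : ∀ {m} {a i : Fin m} k → ¬ a ≡ i → occ a (List.replicate k i) ≡ 0
occ-replicate-other zero    a≢i = refl
occ-replicate-other (suc k) a≢i = trans (occ-there _ a≢i) (occ-replicate-other k a≢i)

occ-base : ∀ m k (a : Fin m) → occ a (baseWord (replicate m k)) ≡ k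
occ-base (suc m) k a = begin
  occ a (baseWord (replicate (suc m) k))                      ≡⟨ count-concatMap (a ≟ᶠ_) block (λ i → i) ⟩
  ℕΣ.sum (λ i → occ a (block i))                               ≡⟨ ℕΣ.sum-remove {i = a} (λ i → occ a (block i)) ⟩
  occ a (block a) + ℕΣ.sum (λ i → occ a (block (punchIn a i)))  ≡⟨ cong₂ _+_ (own-block a) (ℕΣ.sum-cong-≗ {m} λ i → other-block (punchIn a i) (punchInᵢ≢i a i ∘ sym)) ⟩
  k + ℕΣ.sum {m} (λ _ → 0)                                     ≡⟨ cong (λ x → k + x) (ℕΣ.sum-replicate-zero m) ⟩
  k + 0                                                        ≡⟨ ℕP.+-identityʳ k ⟩
  k                                                            ∎
  where
  open ≡-Reasoning
  block : Fin (suc m) → List.List (Fin (suc m))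
  block i = List.replicate (lookup (replicate (suc m) k) i) i
  own-block : ∀ i → occ i (block i) ≡ k
  own-block i = trans (cong (λ l → occ i (List.replicate l i)) (VecP.lookup-replicate i k)) (occ-replicate-same i k)
  other-block : ∀ i → ¬ a ≡ i → occ a (block i) ≡ 0
  other-block i a≢i = trans (cong (λ l → occ a (List.replicate l i)) (VecP.lookup-replicate i k)) (occ-replicate-other k a≢i)

P′-moments : ∀ m k → + P′ (replicate m k) ≡ moments m (λ _ → k) (λ _ → k) 0
P′-moments m k = trans (derangements-moments u (λ a → occ a u) (sum-occ u))
                       (moments-cong m (occ-base m k) (occ-base m k) 0)
  where u = baseWord (replicate m k)

pos-^ : ∀ b t → + (b ^ t) ≡ (+ b) ^ℤ t
pos-^ b zero    = refl
pos-^ b (suc t) = trans (ℤP.pos-* b (b ^ t)) (cong (+ b *ℤ_) (pos-^ b t))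

module Replicated (k : ℕ) where

  -- A m = P′(k, …, k) with m letters, read in ℤ, and ρ = f_{k,k}(0) = (−1)ᵏ.
  A : ℕ → ℤ
  A m = + P′ (replicate m k)

  ρ : ℤ
  ρ = head (factor k k)

  κ : ∀ {m} → Vector ℕ m
  κ _ = k

  moments-replicated : ∀ n m → moments (n + m) κ κ ≗ power (factor k k) n (moments m κ κ)
  moments-replicated zero    m c = refl
  moments-replicated (suc n) m c = ⊛-cong (factor k k) (moments-replicated n m) c

  A-shift : ∀ n m → A (n + m) ≡ ρ ^ℤ n *ℤ A m [mod n ]
  A-shift n m = begin
    A (n + m)                                  ≡⟨ P′-moments (n + m) k ⟩
    moments (n + m) κ κ 0                      ≡⟨ moments-replicated n m 0 ⟩
    power (factor k k) n (moments m κ κ) 0     ≈⟨ power-moments (factor k k) n m κ κ 0 ⟩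
    ρ ^ℤ n *ℤ moments m κ κ 0                  ≡⟨ cong (ρ ^ℤ n *ℤ_) (P′-moments m k) ⟨
    ρ ^ℤ n *ℤ A m                              ∎
    where open SetoidReasoning (modSetoid {n})

  A-multiple : ∀ n t r → A (n * t + r) ≡ (ρ ^ℤ n) ^ℤ t *ℤ A r [mod n ]
  A-multiple n zero    r = ≡⇒≡mod (trans (cong (λ m → A (m + r)) (ℕP.*-zeroʳ n)) (sym (ℤP.*-identityˡ (A r))))
  A-multiple n (suc t) r = begin
    A (n * suc t + r)                          ≡⟨ cong A regroup ⟩
    A (n + (n * t + r))                        ≈⟨ A-shift n (n * t + r) ⟩
    ρ ^ℤ n *ℤ A (n * t + r)                    ≈⟨ mod-*ˡ (ρ ^ℤ n) (A-multiple n t r) ⟩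
    ρ ^ℤ n *ℤ ((ρ ^ℤ n) ^ℤ t *ℤ A r)           ≡⟨ ℤP.*-assoc (ρ ^ℤ n) ((ρ ^ℤ n) ^ℤ t) (A r) ⟨
    (ρ ^ℤ n) ^ℤ suc t *ℤ A r                   ∎
    where
    open SetoidReasoning (modSetoid {n})
    regroup : n * suc t + r ≡ n + (n * t + r)
    regroup = trans (cong (_+ r) (ℕP.*-suc n t)) (ℕP.+-assoc n (n * t) r)

  A-period : ∀ n → A n ≡ ρ ^ℤ n [mod n ]
  A-period n = begin
    A n                   ≡⟨ cong A (ℕP.+-identityʳ n) ⟨
    A (n + 0)             ≈⟨ A-shift n 0 ⟩
    ρ ^ℤ n *ℤ A 0         ≡⟨ ℤP.*-identityʳ (ρ ^ℤ n) ⟩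
    ρ ^ℤ n                ∎
    where open SetoidReasoning (modSetoid {n})

-- Iterating A-shift and using A-period.
corollary5p2 : (n k t r : ℕ) → .{{_ : NonZero n}} → NonZero k →
    (P′ (replicate (n * t + r) k)) % n
      ≡ (P′ (replicate r k) * (P′ (replicate n k)) ^ t) % n
corollary5p2 n k t r _ = mod⇒% n (begin
  A (n * t + r)                       ≈⟨ A-multiple n t r ⟩
  (ρ ^ℤ n) ^ℤ t *ℤ A r                ≈⟨ mod-*ʳ (A r) (mod-^ t (mod-sym (A-period n))) ⟩
  A n ^ℤ t *ℤ A r                     ≡⟨ ℤP.*-comm (A n ^ℤ t) (A r) ⟩
  A r *ℤ A n ^ℤ t                     ≡⟨ cong (A r *ℤ_) (pos-^ (P′ (replicate n k)) t) ⟨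
  A r *ℤ + (P′ (replicate n k) ^ t)   ≡⟨ ℤP.pos-* (P′ (replicate r k)) _ ⟨
  + (P′ (replicate r k) * P′ (replicate n k) ^ t) ∎)
  where
  open Replicated k
  open SetoidReasoning (modSetoid {n})
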